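{- For every integer $n\ge 3$, $|B_n(312,321)|=3\cdot 2^{n-3}$.
   Context: A permutation $\sigma\in S_n$ is written as $\sigma(1)\cdots\sigma(n)$. An index $i\in[n-1]$ is an ascent if $\sigma(i)<\sigma(i+1)$ and a descent if $\sigma(i)>\sigma(i+1)$. A ballot permutation is a permutation such that every prefix $\sigma(1)\cdots\sigma(p)$ has at least as many ascents as descents. $\sigma$ contains a pattern $\pi\in S_k$ if some subsequence $\sigma(c_1)\cdots\sigma(c_k)$ with $c_1<\dots<c_k$ is order-isomorphic to $\pi$, and avoids $\pi$ otherwise. $B_n(\pi_1,\dots,\pi_m)$ denotes the set of ballot permutations of length $n$ avoiding all of $\pi_1,\dots,\pi_m$. -}

module Defs where

open import Data.Bool using (Bool; true; false; _∧_; not; if_then_else_)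
open import Data.Nat using (ℕ; zero; suc; _<ᵇ_; _≡ᵇ_; _≤ᵇ_; _+_)
open import Data.Fin using (Fin; toℕ)
open import Data.Vec using (Vec; []; _∷_; toList)
open import Data.List as L using (List; []; _∷_; length; filter; concatMap; allFin; inits)
open import Data.Bool.ListAction using (any; all; and)
open import Relation.Nullary.Decidable using (Dec)
open import Data.Bool.Properties using (T?)

-- A permutation of [n] is represented as the word σ(1)⋯σ(n) with values
-- in Fin n (i.e. {0,…,n-1}; the shift by one is irrelevant for patterns),
-- as a vector of length n with pairwise distinct entries.

allWords : (m k : ℕ) → List (Vec (Fin k) m)
allWords zero    k = [] ∷ []
allWords (suc m) k = concatMap (λ v → L.map (_∷ v) (allFin k)) (allWords m k)

allDistinct : List ℕ → Bool
allDistinct []       = true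
allDistinct (x ∷ xs) = not (any (λ y → x ≡ᵇ y) xs) ∧ allDistinct xs

ascents : List ℕ → ℕ
ascents (x ∷ y ∷ xs) = (if x <ᵇ y then 1 else 0) + ascents (y ∷ xs)
ascents _            = 0

descents : List ℕ → ℕ
descents (x ∷ y ∷ xs) = (if y <ᵇ x then 1 else 0) + descents (y ∷ xs)
descents _            = 0

isBallot : List ℕ → Bool
isBallot w = all (λ p → descents p ≤ᵇ ascents p) (inits w)

subseqs : List ℕ → List (List ℕ)
subseqs []       = [] ∷ []
subseqs (x ∷ xs) = L.map (x ∷_) (subseqs xs) L.++ subseqs xs

sameOrder : ℕ → ℕ → ℕ → ℕ → Bool
sameOrder a a' b b' = (a <ᵇ a') ≡ᵇb (b <ᵇ b')
  where
  _≡ᵇb_ : Bool → Bool → Bool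
  true  ≡ᵇb true  = true
  false ≡ᵇb false = true
  _     ≡ᵇb _     = false

orderIso : List ℕ → List ℕ → Bool
orderIso []       []       = true
orderIso (a ∷ as) (b ∷ bs) =
  and (L.zipWith (λ a' b' → sameOrder a a' b b') as bs) ∧ orderIso as bs
orderIso _        _        = false

contains : List ℕ → List ℕ → Bool
contains w π = any (λ s → orderIso s π) (subseqs w)

avoids : List ℕ → List ℕ → Bool
avoids w π = not (contains w π)

inB : {n : ℕ} → Vec (Fin n) n → Bool
inB σ = let w = L.map toℕ (toList σ) in
  allDistinct w ∧ isBallot w ∧ avoids w (3 ∷ 1 ∷ 2 ∷ []) ∧ avoids w (3 ∷ 2 ∷ 1 ∷ [])

countB : ℕ → ℕ
countB n = length (filter (λ σ → T? (inB σ)) (allWords n n))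

module Submission where

-- A word avoids 312 and 321 exactly when each of its entries is followed by at most one
-- smaller entry.  So in an element of B_{n+1}(312,321) the maximum n is the last or the
-- second-to-last entry, and deleting it leaves an element of B_n(312,321).  Conversely both
-- ways of inserting n into an element of B_n(312,321) (at the end, or just before the last
-- entry) stay inside the class.  The only delicate point is the ballot condition after
-- deleting n from a word ending in p q n z with z < q: the step p → q must be an ascent,
-- since p ≥ q > z would be a 321, so the prefix ending in q has a spare ascent.  This needs
-- the letter p, i.e. n ≥ 3.  Hence |B_{n+1}(312,321)| = 2 |B_n(312,321)| for n ≥ 3, and
-- |B_3(312,321)| = 3 is computed.

open import Defs
open import Algebra.Bundles using (CommutativeMonoid)
open import Data.Bool using (Bool; true; false; _∧_; _∨_; not; T)
open import Data.Bool.Properties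
  using ( T?; T-∧; T-∨; T-≡; ¬-not; not-involutive; ∧-conicalʳ; ∧-distribˡ-∨
        ; ∨-assoc; ∨-identityʳ; ∨-commutativeMonoid)
open import Data.Bool.ListAction using (any; all)
open import Data.Empty using (⊥; ⊥-elim)
open import Data.Fin using (Fin; toℕ; fromℕ<)
open import Data.Fin.Properties using (toℕ<n; toℕ-injective; toℕ-fromℕ<)
open import Data.List as List
  using (List; []; _∷_; _++_; _∷ʳ_; map; length; filter; allFin; initLast; _∷ʳ′_)
open import Data.List.Properties
  using ( length-map; length-++; ++-identityʳ; ++-conicalʳ; ∷-injectiveˡ; ∷-injectiveʳ
        ; ∷ʳ-++; ∷ʳ-injective; ∷ʳ-injectiveˡ; ∷ʳ-injectiveʳ)
open import Data.List.Membership.Propositional using (_∈_; _∉_)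
open import Data.List.Membership.Propositional.Properties
  using (∈-∃++; ∈-map⁺; ∈-map⁻; ∈-++⁺ˡ; ∈-++⁺ʳ; ∈-++⁻; ∈-concat⁺′; ∈-allFin; ∈-filter⁺; ∈-filter⁻)
open import Data.List.Membership.Propositional.Properties.WithK using (unique∧set⇒bag)
open import Data.List.Relation.Unary.All as All using (All; []; _∷_)
open import Data.List.Relation.Unary.All.Properties as All using (¬Any⇒All¬)
open import Data.List.Relation.Unary.AllPairs as AllPairs using ([]; _∷_)
open import Data.List.Relation.Unary.AllPairs.Properties as AllPairs using ()
open import Data.List.Relation.Unary.Any using (here; there)
open import Data.List.Relation.Unary.Any.Properties using (any⁺; any⁻)
open import Data.List.Relation.Unary.Unique.Propositional using (Unique)
open import Data.List.Relation.Unary.Unique.Propositional.Properties as Unique using ()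
open import Data.List.Relation.Binary.BagAndSetEquality using (∼bag⇒↭)
open import Data.List.Relation.Binary.Disjoint.Propositional using (Disjoint)
open import Data.List.Relation.Binary.Permutation.Propositional.Properties using (↭-length)
open import Data.List.Relation.Binary.Sublist.Propositional as Sublist using (_⊆_; []; _∷_; ⊆-refl)
open import Data.List.Relation.Binary.Sublist.Propositional.Properties
  using (All-resp-⊆; Any-resp-⊆; ++⁺; ++⁺ˡ)
open import Data.Nat
  using ( ℕ; zero; suc; _+_; _*_; _^_; _∸_; _<_; _≤_; z≤n; s≤s; s≤s⁻¹
        ; _<ᵇ_; _≤ᵇ_; _≡ᵇ_; _≟_; _≤?_; _<?_)
open import Data.List.Membership.DecPropositional _≟_ using (_∈?_)
open import Data.Nat.Properties
  using ( <ᵇ-reflects-<; <⇒<ᵇ; ≡ᵇ⇒≡; ≡⇒≡ᵇ; <-irrefl; <-asym; <⇒≤; ≤⇒≯; ≮⇒≥; ≰⇒>; ≤∧≢⇒<; 1+n≰n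
        ; ≤-trans; n≤1+n; n<1+n; m<n⇒m<1+n; suc-injective; +-suc; +-identityʳ; *-distribˡ-+)
open import Data.Product as Product using (Σ; ∃; _×_; _,_; proj₁; proj₂)
open import Data.Sum as Sum using (_⊎_; inj₁; inj₂)
open import Data.Vec as Vec using (Vec; []; _∷_; toList)
import Data.Vec.Properties as Vec
open import Function using (_∘_; case_of_)
open import Function.Bundles using (Equivalence; _⇔_; mk⇔)
open import Relation.Nullary using (Dec; yes; no; contradiction)
open import Relation.Nullary.Reflects using (ofʸ)
open import Relation.Binary.PropositionalEquality
  using (_≡_; _≢_; refl; sym; trans; cong; cong₂; subst; module ≡-Reasoning)
open import Algebra.Properties.CommutativeSemigroup
  (CommutativeMonoid.commutativeSemigroup ∨-commutativeMonoid) using (interchange)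

open Equivalence using (to; from)

T-∨-map : ∀ {a b c d} → (T a → T c) → (T b → T d) → T (a ∨ b) → T (c ∨ d)
T-∨-map f g = from T-∨ ∘ Sum.map f g ∘ to T-∨

T-not-¬ : ∀ {a} → T (not a) → T a → ⊥
T-not-¬ {false} _ ()

T-not-contra : ∀ {a b} → (T a → T b) → T (not b) → T (not a)
T-not-contra {true}  {true}  _ ()
T-not-contra {true}  {false} f _ = f _
T-not-contra {false}         _ _ = _

not-∧ : ∀ a b → not (a ∧ b) ≡ (not a ∨ not b)
not-∧ true  b = refl
not-∧ false b = refl

not-∨ : ∀ a b → not (a ∨ b) ≡ (not a ∧ not b)
not-∨ true  b = refl
not-∨ false b = refl

any-++ : ∀ {A : Set} (f : A → Bool) xs ys → any f (xs ++ ys) ≡ (any f xs ∨ any f ys)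
any-++ f []       ys = refl
any-++ f (x ∷ xs) ys = trans (cong (f x ∨_) (any-++ f xs ys)) (sym (∨-assoc (f x) _ _))

any-map : ∀ {A B : Set} (f : B → Bool) (g : A → B) xs → any f (map g xs) ≡ any (f ∘ g) xs
any-map f g []       = refl
any-map f g (x ∷ xs) = cong (f (g x) ∨_) (any-map f g xs)

all-map : ∀ {A B : Set} (f : B → Bool) (g : A → B) xs → all f (map g xs) ≡ all (f ∘ g) xs
all-map f g []       = refl
all-map f g (x ∷ xs) = cong (f (g x) ∧_) (all-map f g xs)

all-cong : ∀ {A : Set} {f g : A → Bool} → (∀ a → f a ≡ g a) → ∀ xs → all f xs ≡ all g xs
all-cong f≗g []       = refl
all-cong f≗g (x ∷ xs) = cong₂ _∧_ (f≗g x) (all-cong f≗g xs)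

_≥ᵇ_ : ℕ → ℕ → Bool
x ≥ᵇ y = not (x <ᵇ y)

<⇒≱ᵇ : ∀ {x y} → x < y → (x ≥ᵇ y) ≡ false
<⇒≱ᵇ x<y = cong not (to T-≡ (<⇒<ᵇ x<y))

≤⇒≥ᵇ : ∀ {x y} → y ≤ x → T (x ≥ᵇ y)
≤⇒≥ᵇ {x} {y} y≤x with x <ᵇ y | <ᵇ-reflects-< x y
... | true  | ofʸ x<y = ≤⇒≯ y≤x x<y
... | false | _       = _

-- Avoiding 312 and 321

twoAtMost : ℕ → List ℕ → Bool
twoAtMost x []      = false
twoAtMost x (y ∷ v) = (x ≥ᵇ y ∧ any (x ≥ᵇ_) v) ∨ twoAtMost x v

atMostOneSmallerAfter : List ℕ → Bool
atMostOneSmallerAfter []      = true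
atMostOneSmallerAfter (x ∷ v) = not (twoAtMost x v) ∧ atMostOneSmallerAfter v

any-subseqs-∷ : ∀ (f : List ℕ → Bool) x v →
                any f (subseqs (x ∷ v)) ≡ (any (f ∘ (x ∷_)) (subseqs v) ∨ any f (subseqs v))
any-subseqs-∷ f x v =
  trans (any-++ f (map (x ∷_) (subseqs v)) (subseqs v)) (cong (_∨ any f (subseqs v)) (any-map f (x ∷_) (subseqs v)))

any-subseqs-≡-at-[] : ∀ (f : List ℕ → Bool) → (∀ x s → f (x ∷ s) ≡ false) →
                      ∀ v → any f (subseqs v) ≡ f []
any-subseqs-≡-at-[] f f∷≡false []      = ∨-identityʳ (f [])
any-subseqs-≡-at-[] f f∷≡false (x ∷ v) = begin
  any f (subseqs (x ∷ v))                           ≡⟨ any-subseqs-∷ f x v ⟩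
  any (f ∘ (x ∷_)) (subseqs v) ∨ any f (subseqs v)
    ≡⟨ cong₂ _∨_ (any-subseqs-≡-at-[] (f ∘ (x ∷_)) (λ y s → f∷≡false x (y ∷ s)) v)
                 (any-subseqs-≡-at-[] f f∷≡false v) ⟩
  f (x ∷ []) ∨ f []                                 ≡⟨ cong (_∨ f []) (f∷≡false x []) ⟩
  f []                                              ∎
  where open ≡-Reasoning

orderIso⇒length≡ : ∀ u π → orderIso u π ≡ true → length u ≡ length π
orderIso⇒length≡ []      []      _  = refl
orderIso⇒length≡ (a ∷ u) (b ∷ π) eq = cong suc (orderIso⇒length≡ u π (∧-conicalʳ _ _ eq))

p312 p321 : List ℕ
p312 = 3 ∷ 1 ∷ 2 ∷ []
p321 = 3 ∷ 2 ∷ 1 ∷ []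

occursFrom : List ℕ → List ℕ → List ℕ → Bool
occursFrom π u v = any (λ s → orderIso (u ++ s) π) (subseqs v)

extends312∨321 : List ℕ → List ℕ → Bool
extends312∨321 u v = occursFrom p312 u v ∨ occursFrom p321 u v

orderIso-312∨321 : ∀ x y z →
  (orderIso (x ∷ y ∷ z ∷ []) p312 ∨ orderIso (x ∷ y ∷ z ∷ []) p321) ≡ (x ≥ᵇ y ∧ x ≥ᵇ z)
orderIso-312∨321 x y z with x <ᵇ y | x <ᵇ z | y <ᵇ z
... | true  | _     | _     = refl
... | false | true  | _     = refl
... | false | false | true  = refl
... | false | false | false = refl

extends312∨321-pair : ∀ x y v → extends312∨321 (x ∷ y ∷ []) v ≡ (x ≥ᵇ y ∧ any (x ≥ᵇ_) v)
extends312∨321-pair x y [] with x <ᵇ y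
... | true  = refl
... | false = refl
extends312∨321-pair x y (z ∷ v) = begin
  extends312∨321 xy (z ∷ v)
    ≡⟨ cong₂ _∨_ (occursFrom-∷ p312 refl) (occursFrom-∷ p321 refl) ⟩
  (orderIso xyz p312 ∨ occursFrom p312 xy v) ∨ (orderIso xyz p321 ∨ occursFrom p321 xy v)
    ≡⟨ interchange (orderIso xyz p312) _ _ _ ⟩
  (orderIso xyz p312 ∨ orderIso xyz p321) ∨ extends312∨321 xy v
    ≡⟨ cong₂ _∨_ (orderIso-312∨321 x y z) (extends312∨321-pair x y v) ⟩
  (x ≥ᵇ y ∧ x ≥ᵇ z) ∨ (x ≥ᵇ y ∧ any (x ≥ᵇ_) v)
    ≡⟨ ∧-distribˡ-∨ (x ≥ᵇ y) (x ≥ᵇ z) _ ⟨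
  x ≥ᵇ y ∧ any (x ≥ᵇ_) (z ∷ v)
    ∎
  where
  open ≡-Reasoning
  xy  = x ∷ y ∷ []
  xyz = x ∷ y ∷ z ∷ []
  occursFrom-∷ : ∀ π → length π ≡ 3 → occursFrom π xy (z ∷ v) ≡ (orderIso xyz π ∨ occursFrom π xy v)
  occursFrom-∷ π ∣π∣≡3 =
    trans (any-subseqs-∷ _ z v) (cong (_∨ occursFrom π xy v) (any-subseqs-≡-at-[] _ tooLong v))
    where
    tooLong : ∀ a s → orderIso (xyz ++ a ∷ s) π ≡ false
    tooLong a s = ¬-not (λ eq → case trans (orderIso⇒length≡ (x ∷ y ∷ z ∷ a ∷ s) π eq) ∣π∣≡3 of λ ())

extends312∨321-single : ∀ x v → extends312∨321 (x ∷ []) v ≡ twoAtMost x v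
extends312∨321-single x []      = refl
extends312∨321-single x (y ∷ v) = begin
  extends312∨321 (x ∷ []) (y ∷ v)
    ≡⟨ cong₂ _∨_ (any-subseqs-∷ _ y v) (any-subseqs-∷ _ y v) ⟩
  (occursFrom p312 (x ∷ y ∷ []) v ∨ occursFrom p312 (x ∷ []) v)
    ∨ (occursFrom p321 (x ∷ y ∷ []) v ∨ occursFrom p321 (x ∷ []) v)
    ≡⟨ interchange (occursFrom p312 (x ∷ y ∷ []) v) _ _ _ ⟩
  extends312∨321 (x ∷ y ∷ []) v ∨ extends312∨321 (x ∷ []) v
    ≡⟨ cong₂ _∨_ (extends312∨321-pair x y v) (extends312∨321-single x v) ⟩
  twoAtMost x (y ∷ v)
    ∎
  where open ≡-Reasoning

contains-312∨321 : ∀ w → (contains w p312 ∨ contains w p321) ≡ not (atMostOneSmallerAfter w)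
contains-312∨321 []      = refl
contains-312∨321 (x ∷ v) = begin
  contains (x ∷ v) p312 ∨ contains (x ∷ v) p321
    ≡⟨ cong₂ _∨_ (any-subseqs-∷ _ x v) (any-subseqs-∷ _ x v) ⟩
  (occursFrom p312 (x ∷ []) v ∨ contains v p312) ∨ (occursFrom p321 (x ∷ []) v ∨ contains v p321)
    ≡⟨ interchange (occursFrom p312 (x ∷ []) v) _ _ _ ⟩
  extends312∨321 (x ∷ []) v ∨ (contains v p312 ∨ contains v p321)
    ≡⟨ cong₂ _∨_ (extends312∨321-single x v) (contains-312∨321 v) ⟩
  twoAtMost x v ∨ not (atMostOneSmallerAfter v)
    ≡⟨ cong (_∨ _) (not-involutive (twoAtMost x v)) ⟨
  not (not (twoAtMost x v)) ∨ not (atMostOneSmallerAfter v)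
    ≡⟨ not-∧ (not (twoAtMost x v)) _ ⟨
  not (atMostOneSmallerAfter (x ∷ v))
    ∎
  where open ≡-Reasoning

avoids-312-321 : ∀ w → (avoids w p312 ∧ avoids w p321) ≡ atMostOneSmallerAfter w
avoids-312-321 w =
  trans (sym (not-∨ (contains w p312) _)) (trans (cong not (contains-312∨321 w)) (not-involutive _))

anyAtMost-⊆ : ∀ {x v w} → v ⊆ w → T (any (x ≥ᵇ_) v) → T (any (x ≥ᵇ_) w)
anyAtMost-⊆ τ = any⁺ _ ∘ Any-resp-⊆ τ ∘ any⁻ _ _

twoAtMost-⊆ : ∀ {x v w} → v ⊆ w → T (twoAtMost x v) → T (twoAtMost x w)
twoAtMost-⊆     (y Sublist.∷ʳ τ)        = from T-∨ ∘ inj₂ ∘ twoAtMost-⊆ τ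
twoAtMost-⊆ {x} (_∷_ {x = y} refl τ) with x ≥ᵇ y
... | true  = T-∨-map (anyAtMost-⊆ τ) (twoAtMost-⊆ τ)
... | false = twoAtMost-⊆ τ

atMostOneSmallerAfter-⊆ : ∀ {v w} → v ⊆ w → T (atMostOneSmallerAfter w) → T (atMostOneSmallerAfter v)
atMostOneSmallerAfter-⊆ []               _ = _
atMostOneSmallerAfter-⊆ (y Sublist.∷ʳ τ) t = atMostOneSmallerAfter-⊆ τ (proj₂ (to T-∧ t))
atMostOneSmallerAfter-⊆ (refl ∷ τ)       t =
  let fresh , rest = to T-∧ t in
  from T-∧ (T-not-contra (twoAtMost-⊆ τ) fresh , atMostOneSmallerAfter-⊆ τ rest)

anyAtMost-insert : ∀ {x y} a b → x < y → any (x ≥ᵇ_) (a ++ y ∷ b) ≡ any (x ≥ᵇ_) (a ++ b)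
anyAtMost-insert []      b x<y = cong (_∨ any _ b) (<⇒≱ᵇ x<y)
anyAtMost-insert (z ∷ a) b x<y = cong (_ ∨_) (anyAtMost-insert a b x<y)

twoAtMost-insert : ∀ {x y} a b → x < y → twoAtMost x (a ++ y ∷ b) ≡ twoAtMost x (a ++ b)
twoAtMost-insert         []      b x<y = cong (λ c → (c ∧ _) ∨ twoAtMost _ b) (<⇒≱ᵇ x<y)
twoAtMost-insert {x} (z ∷ a) b x<y =
  cong₂ (λ s t → (x ≥ᵇ z ∧ s) ∨ t) (anyAtMost-insert a b x<y) (twoAtMost-insert a b x<y)

atMostOneSmallerAfter-insert : ∀ a {y b} → All (_< y) a → T (not (twoAtMost y b)) →
                               T (atMostOneSmallerAfter (a ++ b)) → T (atMostOneSmallerAfter (a ++ y ∷ b))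
atMostOneSmallerAfter-insert []      []                       fresh t = from T-∧ (fresh , t)
atMostOneSmallerAfter-insert (x ∷ a) {b = b} (x<y ∷ a<y) fresh t =
  let freshˣ , rest = to T-∧ t in
  from T-∧ ( subst (T ∘ not) (sym (twoAtMost-insert a b x<y)) freshˣ
           , atMostOneSmallerAfter-insert a a<y fresh rest)

twoAtMost-≥ : ∀ {x y z} r → y ≤ x → z ≤ x → T (twoAtMost x (y ∷ z ∷ r))
twoAtMost-≥ r y≤x z≤x = from T-∨ (inj₁ (from T-∧ (≤⇒≥ᵇ y≤x , from T-∨ (inj₁ (≤⇒≥ᵇ z≤x)))))

twoAtMost-singleton : ∀ x z → T (not (twoAtMost x (z ∷ [])))
twoAtMost-singleton x z with x ≥ᵇ z
... | true  = _
... | false = _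

-- Ballot words

-- ballotFrom k x v: after a letter x, with k ascents more than descents so far, no prefix
-- of the continuation v brings the descents above the ascents.
ballotFrom : ℕ → ℕ → List ℕ → Bool
ballotFrom k x []      = true
ballotFrom k x (y ∷ v) with x <ᵇ y | y <ᵇ x | k
... | true  | _     | _     = ballotFrom (suc k) y v
... | false | false | _     = ballotFrom k y v
... | false | true  | zero  = false
... | false | true  | suc j = ballotFrom j y v

ballot : List ℕ → Bool
ballot []      = true
ballot (x ∷ v) = ballotFrom 0 x v

balancedWith : ℕ → List ℕ → Bool
balancedWith k p = descents p ≤ᵇ ascents p + k

<ᵇ-suc : ∀ m n → (m <ᵇ suc n) ≡ (m ≤ᵇ n)
<ᵇ-suc zero    n = refl
<ᵇ-suc (suc m) n = refl

all-inits-ballotFrom : ∀ k x v → all (λ p → balancedWith k (x ∷ p)) (List.Inits.tail v) ≡ ballotFrom k x v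
all-inits-ballotFrom k x []      = refl
all-inits-ballotFrom k x (y ∷ v) =
  trans (cong (balancedWith k (x ∷ y ∷ []) ∧_) (all-map (λ p → balancedWith k (x ∷ p)) (y ∷_) (List.Inits.tail v)))
        (step k)
  where
  step : ∀ k → (balancedWith k (x ∷ y ∷ []) ∧ all (λ p → balancedWith k (x ∷ y ∷ p)) (List.Inits.tail v))
               ≡ ballotFrom k x (y ∷ v)
  step k with x <ᵇ y | <ᵇ-reflects-< x y | y <ᵇ x | <ᵇ-reflects-< y x | k
  ... | true  | ofʸ x<y | true  | ofʸ y<x | _ = ⊥-elim (<-asym x<y y<x)
  ... | true  | _       | false | _       | j =
    trans (all-cong (λ p → cong (descents (y ∷ p) ≤ᵇ_) (sym (+-suc (ascents (y ∷ p)) j))) (List.Inits.tail v))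
          (all-inits-ballotFrom (suc j) y v)
  ... | false | _       | false | _       | j = all-inits-ballotFrom j y v
  ... | false | _       | true  | _       | zero  = refl
  ... | false | _       | true  | _       | suc j =
    trans (all-cong (λ p → trans (cong (descents (y ∷ p) <ᵇ_) (+-suc (ascents (y ∷ p)) j))
                                 (<ᵇ-suc (descents (y ∷ p)) (ascents (y ∷ p) + j)))
                    (List.Inits.tail v))
          (all-inits-ballotFrom j y v)

isBallot≡ballot : ∀ w → isBallot w ≡ ballot w
isBallot≡ballot []      = refl
isBallot≡ballot (x ∷ v) =
  trans (all-map (λ p → descents p ≤ᵇ ascents p) (x ∷_) (List.Inits.tail v))
        (trans (all-cong (λ p → cong (descents (x ∷ p) ≤ᵇ_) (sym (+-identityʳ (ascents (x ∷ p)))))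
                         (List.Inits.tail v))
               (all-inits-ballotFrom 0 x v))

lastOf : ℕ → List ℕ → ℕ
lastOf x []      = x
lastOf x (y ∷ v) = lastOf y v

lastOf-∷ʳ : ∀ x v q → lastOf x (v ∷ʳ q) ≡ q
lastOf-∷ʳ x []      q = refl
lastOf-∷ʳ x (y ∷ v) q = lastOf-∷ʳ y v q

All-lastOf : ∀ {P : ℕ → Set} {x v} → All P (x ∷ v) → P (lastOf x v)
All-lastOf {v = []}    (px ∷ _)  = px
All-lastOf {v = _ ∷ _} (_ ∷ pxs) = All-lastOf pxs

lastOf-⊆ : ∀ x v → lastOf x v ∷ [] ⊆ x ∷ v
lastOf-⊆ x []      = refl ∷ []
lastOf-⊆ x (y ∷ v) = x Sublist.∷ʳ lastOf-⊆ y v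

ballotFrom-++⁻ˡ : ∀ k x v s → T (ballotFrom k x (v ++ s)) → T (ballotFrom k x v)
ballotFrom-++⁻ˡ k x []      s _ = _
ballotFrom-++⁻ˡ k x (y ∷ v) s b with x <ᵇ y | y <ᵇ x | k
... | true  | _     | j     = ballotFrom-++⁻ˡ (suc j) y v s b
... | false | false | j     = ballotFrom-++⁻ˡ j y v s b
... | false | true  | suc j = ballotFrom-++⁻ˡ j y v s b

ballotFrom-∷ʳ-≥ : ∀ k x v z → T (z ≥ᵇ lastOf x v) → T (ballotFrom k x v) → T (ballotFrom k x (v ∷ʳ z))
ballotFrom-∷ʳ-≥ k x []      z _ _ with x <ᵇ z | z <ᵇ x | k
... | true  | _     | _ = _
... | false | false | _ = _
ballotFrom-∷ʳ-≥ k x (y ∷ v) z z≥ b with x <ᵇ y | y <ᵇ x | k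
... | true  | _     | j     = ballotFrom-∷ʳ-≥ (suc j) y v z z≥ b
... | false | false | j     = ballotFrom-∷ʳ-≥ j y v z z≥ b
... | false | true  | suc j = ballotFrom-∷ʳ-≥ j y v z z≥ b

ballotFrom-afterAscent : ∀ k x v q z → T (lastOf x v <ᵇ q) → T (ballotFrom k x (v ∷ʳ q)) →
                         T (ballotFrom k x (v ++ q ∷ z ∷ []))
ballotFrom-afterAscent k x [] q z _ _ with x <ᵇ q
... | true with q <ᵇ z | z <ᵇ q
...   | true  | _     = _
...   | false | true  = _
...   | false | false = _
ballotFrom-afterAscent k x (y ∷ v) q z p<q b with x <ᵇ y | y <ᵇ x | k
... | true  | _     | j     = ballotFrom-afterAscent (suc j) y v q z p<q b
... | false | false | j     = ballotFrom-afterAscent j y v q z p<q b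
... | false | true  | suc j = ballotFrom-afterAscent j y v q z p<q b

ballotFrom-∷ʳ-noDoubleDescent : ∀ k x v q z → q ≤ z ⊎ lastOf x v < q → T (ballotFrom k x (v ∷ʳ q)) →
                                T (ballotFrom k x (v ∷ʳ q ∷ʳ z))
ballotFrom-∷ʳ-noDoubleDescent k x v q z (inj₁ q≤z) =
  ballotFrom-∷ʳ-≥ k x (v ∷ʳ q) z (subst (T ∘ (z ≥ᵇ_)) (sym (lastOf-∷ʳ x v q)) (≤⇒≥ᵇ q≤z))
ballotFrom-∷ʳ-noDoubleDescent k x v q z (inj₂ p<q) =
  subst (T ∘ ballotFrom k x) (sym (∷ʳ-++ v q (z ∷ []))) ∘ ballotFrom-afterAscent k x v q z (<⇒<ᵇ p<q)

ballot-++⁻ˡ : ∀ u s → T (ballot (u ++ s)) → T (ballot u)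
ballot-++⁻ˡ []      s _ = _
ballot-++⁻ˡ (x ∷ v) s   = ballotFrom-++⁻ˡ 0 x v s

ballot-∷ʳ-max : ∀ {y} w → All (_< y) w → T (ballot w) → T (ballot (w ∷ʳ y))
ballot-∷ʳ-max []      _   _ = _
ballot-∷ʳ-max (x ∷ v) w<y   = ballotFrom-∷ʳ-≥ 0 x v _ (≤⇒≥ᵇ (<⇒≤ (All-lastOf w<y)))

ballot-insertBeforeLast : ∀ {y} x v z → All (_< y) (x ∷ v) → T (ballot (x ∷ v ∷ʳ z)) →
                          T (ballot (x ∷ v ++ y ∷ z ∷ []))
ballot-insertBeforeLast x v z xv<y b =
  ballotFrom-afterAscent 0 x v _ z (<⇒<ᵇ (All-lastOf xv<y))
    (ballot-∷ʳ-max (x ∷ v) xv<y (ballotFrom-++⁻ˡ 0 x v (z ∷ []) b))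

ballot-dropSecondLast : ∀ x v q y z → T (atMostOneSmallerAfter (x ∷ v ∷ʳ q ++ y ∷ z ∷ [])) →
                        T (ballot (x ∷ v ∷ʳ q ++ y ∷ z ∷ [])) → T (ballot (x ∷ v ∷ʳ q ∷ʳ z))
ballot-dropSecondLast x v q y z avoiding b =
  ballotFrom-∷ʳ-noDoubleDescent 0 x v q z noDoubleDescent (ballotFrom-++⁻ˡ 0 x (v ∷ʳ q) (y ∷ z ∷ []) b)
  where
  p = lastOf x v
  pqz⊆ : p ∷ q ∷ z ∷ [] ⊆ x ∷ v ∷ʳ q ++ y ∷ z ∷ []
  pqz⊆ = ++⁺ (++⁺ (lastOf-⊆ x v) (refl ∷ [])) (y Sublist.∷ʳ refl ∷ [])
  noDoubleDescent : q ≤ z ⊎ p < q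
  noDoubleDescent with q ≤? z | p <? q
  ... | yes q≤z | _       = inj₁ q≤z
  ... | no _    | yes p<q = inj₂ p<q
  ... | no q≰z  | no p≮q  = ⊥-elim (T-not-¬ (proj₁ (to T-∧ (atMostOneSmallerAfter-⊆ pqz⊆ avoiding)))
                                            (twoAtMost-≥ [] (≮⇒≥ p≮q) (≤-trans (<⇒≤ (≰⇒> q≰z)) (≮⇒≥ p≮q))))

-- Duplicate-free words

fresh⇒All≢ : ∀ x ys → T (not (any (x ≡ᵇ_) ys)) → All (x ≢_) ys
fresh⇒All≢ x []       _ = []
fresh⇒All≢ x (y ∷ ys) t with x ≡ᵇ y in x≡ᵇy
... | false = (λ { refl → subst T x≡ᵇy (≡⇒≡ᵇ x x refl) }) ∷ fresh⇒All≢ x ys t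

All≢⇒fresh : ∀ {x} ys → All (x ≢_) ys → T (not (any (x ≡ᵇ_) ys))
All≢⇒fresh     []       []         = _
All≢⇒fresh {x} (y ∷ ys) (x≢y ∷ ps) with x ≡ᵇ y in x≡ᵇy
... | true  = x≢y (≡ᵇ⇒≡ x y (subst T (sym x≡ᵇy) _))
... | false = All≢⇒fresh ys ps

allDistinct⇒Unique : ∀ w → T (allDistinct w) → Unique w
allDistinct⇒Unique []      _ = []
allDistinct⇒Unique (x ∷ v) t =
  let fresh , distinct = to T-∧ t in fresh⇒All≢ x v fresh ∷ allDistinct⇒Unique v distinct

Unique⇒allDistinct : ∀ {w} → Unique w → T (allDistinct w)
Unique⇒allDistinct         []       = _
Unique⇒allDistinct {x ∷ v} (x∉ ∷ u) = from T-∧ (All≢⇒fresh v x∉ , Unique⇒allDistinct u)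

Unique-resp-⊇ : ∀ {v w : List ℕ} → v ⊆ w → Unique w → Unique v
Unique-resp-⊇ []               []       = []
Unique-resp-⊇ (y Sublist.∷ʳ τ) (_ ∷ u)  = Unique-resp-⊇ τ u
Unique-resp-⊇ (refl ∷ τ)       (x∉ ∷ u) = All-resp-⊆ τ x∉ ∷ Unique-resp-⊇ τ u

⊆-insert : ∀ (a : List ℕ) y b → a ++ b ⊆ a ++ y ∷ b
⊆-insert a y b = ++⁺ (⊆-refl {x = a}) (y Sublist.∷ʳ ⊆-refl)

length-insert : ∀ (a : List ℕ) y b → length (a ++ y ∷ b) ≡ suc (length (a ++ b))
length-insert []      y b = refl
length-insert (x ∷ a) y b = cong suc (length-insert a y b)

All-insert : ∀ {P : ℕ → Set} a {y b} → All P (a ++ b) → P y → All P (a ++ y ∷ b)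
All-insert a pab py = All.++⁺ (All.++⁻ˡ a pab) (py ∷ All.++⁻ʳ a pab)

Unique-insert : ∀ (a : List ℕ) {y b} → y ∉ a ++ b → Unique (a ++ b) → Unique (a ++ y ∷ b)
Unique-insert []      y∉ u        = ¬Any⇒All¬ _ y∉ ∷ u
Unique-insert (x ∷ a) y∉ (x∉ ∷ u) =
  All-insert a x∉ (λ x≡y → y∉ (here (sym x≡y))) ∷ Unique-insert a (y∉ ∘ there) u

Unique-insert⇒∉ : ∀ (a : List ℕ) {y b} → Unique (a ++ y ∷ b) → y ∉ a ++ b
Unique-insert⇒∉ []      (y∉ ∷ _) y∈          = All.lookup y∉ y∈ refl
Unique-insert⇒∉ (x ∷ a) (x∉ ∷ u) (here refl) = All.lookup x∉ (∈-++⁺ʳ a (here {xs = _} refl)) refl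
Unique-insert⇒∉ (x ∷ a) (x∉ ∷ u) (there y∈)  = Unique-insert⇒∉ a u y∈

All<suc-∉ : ∀ {k w} → All (_< suc k) w → k ∉ w → All (_< k) w
All<suc-∉ []           k∉ = []
All<suc-∉ (x<1+k ∷ ps) k∉ =
  ≤∧≢⇒< (s≤s⁻¹ x<1+k) (λ x≡k → k∉ (here (sym x≡k))) ∷ All<suc-∉ ps (k∉ ∘ there)

Unique-bounded⇒length≤ : ∀ k {w} → Unique w → All (_< k) w → length w ≤ k
Unique-bounded⇒length≤ zero    {[]}    _ _        = z≤n
Unique-bounded⇒length≤ zero    {x ∷ w} _ (() ∷ _)
Unique-bounded⇒length≤ (suc k) {w}     u w<1+k with k ∈? w
... | no k∉w = ≤-trans (Unique-bounded⇒length≤ k u (All<suc-∉ w<1+k k∉w)) (n≤1+n k)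
... | yes k∈w with a , c , refl ← ∈-∃++ k∈w =
  subst (_≤ suc k) (sym (length-insert a k c))
        (s≤s (Unique-bounded⇒length≤ k (Unique-resp-⊇ (⊆-insert a k c) u)
                                       (All<suc-∉ (All-resp-⊆ (⊆-insert a k c) w<1+k) (Unique-insert⇒∉ a u))))

-- The words of B_n(312,321)

record InB (n : ℕ) (w : List ℕ) : Set where
  constructor mkInB
  field
    length≡  : length w ≡ n
    bounded  : All (_< n) w
    distinct : Unique w
    balanced : T (ballot w)
    avoiding : T (atMostOneSmallerAfter w)
open InB

InB-insertMax : ∀ {n} a {b} → T (not (twoAtMost n b)) → T (ballot (a ++ n ∷ b)) →
                InB n (a ++ b) → InB (suc n) (a ++ n ∷ b)
InB-insertMax {n} a {b} fresh bal w = mkInB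
  (trans (length-insert a n b) (cong suc (length≡ w)))
  (All-insert a (All.map m<n⇒m<1+n (bounded w)) (n<1+n n))
  (Unique-insert a (λ n∈ → <-irrefl refl (All.lookup (bounded w) n∈)) (distinct w))
  bal
  (atMostOneSmallerAfter-insert a (All.++⁻ˡ a (bounded w)) fresh (avoiding w))

InB-deleteMax : ∀ {n} a {b} → T (ballot (a ++ b)) → InB (suc n) (a ++ n ∷ b) → InB n (a ++ b)
InB-deleteMax {n} a {b} bal W = mkInB
  (suc-injective (trans (sym (length-insert a n b)) (length≡ W)))
  (All<suc-∉ (All-resp-⊆ (⊆-insert a n b) (bounded W)) (Unique-insert⇒∉ a (distinct W)))
  (Unique-resp-⊇ (⊆-insert a n b) (distinct W))
  bal
  (atMostOneSmallerAfter-⊆ (⊆-insert a n b) (avoiding W))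

insertBeforeLast : ℕ → List ℕ → List ℕ
insertBeforeLast y []          = []
insertBeforeLast y (x ∷ [])    = y ∷ x ∷ []
insertBeforeLast y (x ∷ z ∷ v) = x ∷ insertBeforeLast y (z ∷ v)

insertBeforeLast-∷ʳ : ∀ y a z → insertBeforeLast y (a ∷ʳ z) ≡ a ∷ʳ y ∷ʳ z
insertBeforeLast-∷ʳ y []           z = refl
insertBeforeLast-∷ʳ y (x ∷ [])     z = refl
insertBeforeLast-∷ʳ y (x ∷ x′ ∷ a) z = cong (x ∷_) (insertBeforeLast-∷ʳ y (x′ ∷ a) z)

InB-∷ʳ-max : ∀ {n w} → InB n w → InB (suc n) (w ∷ʳ n)
InB-∷ʳ-max {n} {w} I =
  InB-insertMax w _ (ballot-∷ʳ-max w (bounded I) (balanced I)) (subst (InB n) (sym (++-identityʳ w)) I)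

InB-insertBeforeLast : ∀ {n w} → 2 ≤ n → InB n w → InB (suc n) (insertBeforeLast n w)
InB-insertBeforeLast {n} {w} 2≤n I with initLast w
... | []            = case subst (2 ≤_) (sym (length≡ I)) 2≤n of λ ()
... | [] ∷ʳ′ z      = case subst (2 ≤_) (sym (length≡ I)) 2≤n of λ { (s≤s ()) }
... | (x ∷ v) ∷ʳ′ z =
  subst (InB (suc n)) (sym (trans (insertBeforeLast-∷ʳ n (x ∷ v) z) (∷ʳ-++ (x ∷ v) n (z ∷ []))))
    (InB-insertMax (x ∷ v) (twoAtMost-singleton n z)
       (ballot-insertBeforeLast x v z (All.++⁻ˡ (x ∷ v) (bounded I)) (balanced I)) I)

InB-max∈ : ∀ {n W} → InB (suc n) W → n ∈ W
InB-max∈ {n} {W} I with n ∈? W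
... | yes n∈W = n∈W
... | no  n∉W = contradiction
  (subst (_≤ n) (length≡ I) (Unique-bounded⇒length≤ n (distinct I) (All<suc-∉ (bounded I) n∉W)))
  1+n≰n

InB-split : ∀ {n W} → 3 ≤ n → InB (suc n) W →
  (∃ λ w → InB n w × W ≡ w ∷ʳ n) ⊎ (∃ λ w → InB n w × W ≡ insertBeforeLast n w)
InB-split {n} 3≤n I with ∈-∃++ (InB-max∈ I)
... | α , [] , refl = inj₁ (α , subst (InB n) (++-identityʳ α) (InB-deleteMax α bal I) , refl)
  where bal = subst (T ∘ ballot) (sym (++-identityʳ α)) (ballot-++⁻ˡ α (n ∷ []) (balanced I))
... | α , z ∷ [] , refl with initLast α
...   | []            = case subst (3 ≤_) (sym (suc-injective (length≡ I))) 3≤n of λ { (s≤s ()) }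
...   | [] ∷ʳ′ q      = case subst (3 ≤_) (sym (suc-injective (length≡ I))) 3≤n of λ { (s≤s (s≤s ())) }
...   | (x ∷ v) ∷ʳ′ q =
  inj₂ ( x ∷ v ∷ʳ q ∷ʳ z
       , InB-deleteMax (x ∷ v ∷ʳ q) (ballot-dropSecondLast x v q n z (avoiding I) (balanced I)) I
       , sym (trans (insertBeforeLast-∷ʳ n (x ∷ v ∷ʳ q) z) (∷ʳ-++ (x ∷ v ∷ʳ q) n (z ∷ []))))
InB-split {n} 3≤n I | α , y₁ ∷ y₂ ∷ r , refl =
  ⊥-elim (T-not-¬ (proj₁ (to T-∧ (atMostOneSmallerAfter-⊆ (++⁺ˡ α ⊆-refl) (avoiding I))))
                  (twoAtMost-≥ r (s≤s⁻¹ y₁<1+n) (s≤s⁻¹ y₂<1+n)))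
  where
  y₁<1+n = All.head (All.tail (All.++⁻ʳ α (bounded I)))
  y₂<1+n = All.head (All.tail (All.tail (All.++⁻ʳ α (bounded I))))

-- Counting

sameMembers⇒length≡ : ∀ {A : Set} {xs ys : List A} → Unique xs → Unique ys →
                      (∀ {z} → z ∈ xs ⇔ z ∈ ys) → length xs ≡ length ys
sameMembers⇒length≡ xs! ys! xs≈ys = ↭-length (∼bag⇒↭ (unique∧set⇒bag xs! ys! xs≈ys))

toWord : ∀ {k m} → Vec (Fin k) m → List ℕ
toWord σ = map toℕ (toList σ)

length-toWord : ∀ {k m} (σ : Vec (Fin k) m) → length (toWord σ) ≡ m
length-toWord []      = refl
length-toWord (_ ∷ σ) = cong suc (length-toWord σ)

toWord-bounded : ∀ {k m} (σ : Vec (Fin k) m) → All (_< k) (toWord σ)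
toWord-bounded []      = []
toWord-bounded (i ∷ σ) = toℕ<n i ∷ toWord-bounded σ

toWord-injective : ∀ {k m} {σ τ : Vec (Fin k) m} → toWord σ ≡ toWord τ → σ ≡ τ
toWord-injective {σ = []}    {[]}    _  = refl
toWord-injective {σ = i ∷ σ} {j ∷ τ} eq =
  cong₂ _∷_ (toℕ-injective (∷-injectiveˡ eq)) (toWord-injective (∷-injectiveʳ eq))

toWord-surjective : ∀ {k m} w → length w ≡ m → All (_< k) w → Σ (Vec (Fin k) m) λ σ → toWord σ ≡ w
toWord-surjective {m = zero}  []      _   []          = [] , refl
toWord-surjective {m = suc m} (x ∷ w) len (x<k ∷ w<k) with σ , eq ← toWord-surjective w (suc-injective len) w<k =
  fromℕ< x<k ∷ σ , cong₂ _∷_ (toℕ-fromℕ< x<k) eq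

∈-allWords : ∀ {k m} (σ : Vec (Fin k) m) → σ ∈ allWords m k
∈-allWords     []      = here refl
∈-allWords {k} (i ∷ σ) =
  ∈-concat⁺′ (∈-map⁺ (_∷ σ) (∈-allFin i)) (∈-map⁺ (λ τ → map (_∷ τ) (allFin k)) (∈-allWords σ))

allWords-unique : ∀ m k → Unique (allWords m k)
allWords-unique zero    k = [] ∷ []
allWords-unique (suc m) k =
  Unique.concat⁺ (All.map⁺ (All.universal (λ _ → Unique.map⁺ Vec.∷-injectiveˡ (Unique.allFin⁺ k)) (allWords m k)))
                 (AllPairs.map⁺ (AllPairs.map disjoint (allWords-unique m k)))
  where
  disjoint : ∀ {σ τ : Vec (Fin k) m} → σ ≢ τ → Disjoint (map (_∷ σ) (allFin k)) (map (_∷ τ) (allFin k))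
  disjoint σ≢τ (p , q) with ∈-map⁻ (_∷ _) p | ∈-map⁻ (_∷ _) q
  ... | _ , _ , refl | _ , _ , eq = σ≢τ (Vec.∷-injectiveʳ eq)

inB? : ∀ {n} (σ : Vec (Fin n) n) → Dec (T (inB σ))
inB? σ = T? (inB σ)

bWords : ℕ → List (List ℕ)
bWords n = map toWord (filter inB? (allWords n n))

countB≡length-bWords : ∀ n → countB n ≡ length (bWords n)
countB≡length-bWords n = sym (length-map toWord (filter inB? (allWords n n)))

bWords-unique : ∀ n → Unique (bWords n)
bWords-unique n = Unique.map⁺ toWord-injective (Unique.filter⁺ inB? (allWords-unique n n))

inB⇔InB : ∀ {n} (σ : Vec (Fin n) n) → T (inB σ) ⇔ InB n (toWord σ)
inB⇔InB σ = mk⇔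
  (λ t → let d , b∧a = to T-∧ (subst T inB≡ t); b , a = to T-∧ b∧a in
         mkInB (length-toWord σ) (toWord-bounded σ) (allDistinct⇒Unique _ d) b a)
  (λ I → subst T (sym inB≡) (from T-∧ (Unique⇒allDistinct (distinct I) , from T-∧ (balanced I , avoiding I))))
  where
  w = toWord σ
  inB≡ : inB σ ≡ (allDistinct w ∧ ballot w ∧ atMostOneSmallerAfter w)
  inB≡ = cong₂ (λ b c → allDistinct w ∧ b ∧ c) (isBallot≡ballot w) (avoids-312-321 w)

∈-bWords⇔InB : ∀ {n w} → w ∈ bWords n ⇔ InB n w
∈-bWords⇔InB {n} {w} = mk⇔
  (λ w∈ → let σ , σ∈ , w≡ = ∈-map⁻ toWord w∈ in
          subst (InB n) (sym w≡) (to (inB⇔InB σ) (proj₂ (∈-filter⁻ inB? {xs = allWords n n} σ∈))))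
  (λ I → let σ , σ≡w = toWord-surjective w (length≡ I) (bounded I) in
         subst (_∈ bWords n) σ≡w
           (∈-map⁺ toWord (∈-filter⁺ inB? (∈-allWords σ) (from (inB⇔InB σ) (subst (InB n) (sym σ≡w) I)))))

insertBeforeLast-injective : ∀ y {v w} → insertBeforeLast y v ≡ insertBeforeLast y w → v ≡ w
insertBeforeLast-injective y {v} {w} eq with initLast v | initLast w
... | []      | []       = refl
... | []      | b ∷ʳ′ z′ = case ++-conicalʳ (b ∷ʳ y) _ (sym (trans eq (insertBeforeLast-∷ʳ y b z′))) of λ ()
... | a ∷ʳ′ z | []       = case ++-conicalʳ (a ∷ʳ y) _ (trans (sym (insertBeforeLast-∷ʳ y a z)) eq) of λ ()
... | a ∷ʳ′ z | b ∷ʳ′ z′ with ∷ʳ-injective (a ∷ʳ y) (b ∷ʳ y)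
                                (trans (sym (insertBeforeLast-∷ʳ y a z)) (trans eq (insertBeforeLast-∷ʳ y b z′)))
...   | a∷ʳy≡b∷ʳy , refl = cong (_∷ʳ z) (∷ʳ-injectiveˡ a b a∷ʳy≡b∷ʳy)

children : ℕ → List (List ℕ)
children n = map (_∷ʳ n) (bWords n) ++ map (insertBeforeLast n) (bWords n)

children-unique : ∀ n → Unique (children n)
children-unique n =
  Unique.++⁺ (Unique.map⁺ (∷ʳ-injectiveˡ _ _) (bWords-unique n))
             (Unique.map⁺ (insertBeforeLast-injective n) (bWords-unique n))
             disjoint
  where
  disjoint : Disjoint (map (_∷ʳ n) (bWords n)) (map (insertBeforeLast n) (bWords n))
  disjoint (p , q) with ∈-map⁻ (_∷ʳ n) p | ∈-map⁻ (insertBeforeLast n) q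
  ... | w , _ , refl | w′ , w′∈ , eq with initLast w′
  ...   | []      = case ++-conicalʳ w _ eq of λ ()
  ...   | a ∷ʳ′ z = <-irrefl (sym (∷ʳ-injectiveʳ w (a ∷ʳ n) (trans eq (insertBeforeLast-∷ʳ n a z))))
                             (All.lookup (bounded (to ∈-bWords⇔InB w′∈)) (∈-++⁺ʳ a (here refl)))

bWords-suc≈children : ∀ {n} → 3 ≤ n → ∀ {W} → W ∈ bWords (suc n) ⇔ W ∈ children n
bWords-suc≈children {n} 3≤n = mk⇔ split merge
  where
  split : ∀ {W} → W ∈ bWords (suc n) → W ∈ children n
  split W∈ with InB-split 3≤n (to ∈-bWords⇔InB W∈)
  ... | inj₁ (w , I , refl) = ∈-++⁺ˡ (∈-map⁺ (_∷ʳ n) (from ∈-bWords⇔InB I))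
  ... | inj₂ (w , I , refl) = ∈-++⁺ʳ _ (∈-map⁺ (insertBeforeLast n) (from ∈-bWords⇔InB I))
  merge : ∀ {W} → W ∈ children n → W ∈ bWords (suc n)
  merge W∈ with ∈-++⁻ (map (_∷ʳ n) (bWords n)) W∈
  ... | inj₁ p with w , w∈ , refl ← ∈-map⁻ (_∷ʳ n) p =
    from ∈-bWords⇔InB (InB-∷ʳ-max (to ∈-bWords⇔InB w∈))
  ... | inj₂ q with w , w∈ , refl ← ∈-map⁻ (insertBeforeLast n) q =
    from ∈-bWords⇔InB (InB-insertBeforeLast (≤-trans (n≤1+n 2) 3≤n) (to ∈-bWords⇔InB w∈))

countB-suc : ∀ n → 3 ≤ n → countB (suc n) ≡ countB n + countB n
countB-suc n 3≤n = begin
  countB (suc n)                        ≡⟨ countB≡length-bWords (suc n) ⟩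
  length (bWords (suc n))               ≡⟨ sameMembers⇒length≡ (bWords-unique (suc n)) (children-unique n)
                                                                (bWords-suc≈children 3≤n) ⟩
  length (children n)                   ≡⟨ length-++ (map (_∷ʳ n) (bWords n)) ⟩
  length (map (_∷ʳ n) (bWords n)) + length (map (insertBeforeLast n) (bWords n))
                                        ≡⟨ cong₂ _+_ (length-map _ (bWords n)) (length-map _ (bWords n)) ⟩
  length (bWords n) + length (bWords n) ≡⟨ cong₂ _+_ (countB≡length-bWords n) (countB≡length-bWords n) ⟨
  countB n + countB n                   ∎
  where open ≡-Reasoning

countB-3+ : ∀ m → countB (3 + m) ≡ 3 * 2 ^ m
countB-3+ zero    = refl
countB-3+ (suc m) = begin
  countB (4 + m)                  ≡⟨ countB-suc (3 + m) (s≤s (s≤s (s≤s z≤n))) ⟩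
  countB (3 + m) + countB (3 + m) ≡⟨ cong₂ _+_ (countB-3+ m) (countB-3+ m) ⟩
  3 * 2 ^ m + 3 * 2 ^ m           ≡⟨ *-distribˡ-+ 3 (2 ^ m) (2 ^ m) ⟨
  3 * (2 ^ m + 2 ^ m)             ≡⟨ cong (λ k → 3 * (2 ^ m + k)) (+-identityʳ (2 ^ m)) ⟨
  3 * 2 ^ suc m                   ∎
  where open ≡-Reasoning

theorem3p14 : (n : ℕ) → 3 ≤ n → countB n ≡ 3 * 2 ^ (n ∸ 3)
theorem3p14 (suc (suc (suc m))) _              = countB-3+ m
theorem3p14 (suc zero)          (s≤s ())
theorem3p14 (suc (suc zero))    (s≤s (s≤s ()))
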